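{- In each of the following cases there exists an ascending partition $\mathcal P=[p_1,\ldots,p_k]$ of $n$ of size $k$ with $p_1=\cdots=p_e=2$ and $p_{e+1}=\cdots=p_{e+f}=3$ (i.e. completing the partial partition $[2^e,3^f]$) such that $s^{n,k}$ is an integer, $\mathrm{slack}(\mathcal P)\ge 0$, and $\mathcal P$ is not equitable: (a) $n=6t+3$, $k=2t+1$, $e=\frac32 t$, $f=2$, for every even $t\ge 6$; (b) $n=6t+3$, $k=2t+1$, $e=\frac32 t-\frac12$, $f=3$, for every odd $t\ge 7$; (c) $n=6t+2$, $k=2t+1$, $e=\frac32 t$, $f=3$, for every even $t\ge 10$; (d) $n=6t+2$, $k=2t+1$, $e=\frac32 t+\frac12$, $f=2$, for every odd $t\ge 11$.
   Context: $[n]=\{1,\ldots,n\}$ and $s^{n,k}=\frac{n(n+1)}{2k}$. An ascending partition of $n$ of size $k$ is a sequence of positive integers $p_1\le\cdots\le p_k$ with $\sum_i p_i=n$. It is equitable if $[n]$ can be partitioned into sets $A_1,\ldots,A_k$ with $|A_i|=p_i$ and all element sums equal. For $j=1,\ldots,k$, $\mathrm{slack}_j(\mathcal P)=\sum_{i=1}^{p_1+\cdots+p_j}(n-i+1)-j\,s^{n,k}$, and $\mathrm{slack}(\mathcal P)=\min_{1\le j\le k-1}\mathrm{slack}_j(\mathcal P)$. -}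

module Defs where

open import Data.Nat using (ℕ; zero; suc; _+_; _*_; _∸_; _≤_; _<_; NonZero)
open import Data.Nat.Properties using (m*n≢0)
open import Data.Nat.ListAction using (sum)
open import Data.Empty using (⊥)
open import Data.Fin as Fin using (Fin; toℕ)
open import Data.Fin.Properties using (_≟_)
open import Data.Vec using (Vec; lookup; toList)
import Data.Vec as Vec
open import Data.List using (List; length; filter; map; upTo; take; allFin)
open import Data.Integer using (ℤ; +_)
open import Data.Rational as ℚ using (ℚ; _/_; 0ℚ)
open import Data.Product using (Σ; ∃; _×_)
open import Relation.Binary.PropositionalEquality using (_≡_)

-- An ascending partition of n of size k: p_1 ≤ ... ≤ p_k, all positive, summing to n.
-- (lookup p i is p_{i+1}; indices are 0-based.)
IsAscendingPartition : (n k : ℕ) → Vec ℕ k → Set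
IsAscendingPartition n k p =
  (∀ (i : Fin k) → 1 ≤ lookup p i) ×
  (∀ (i j : Fin k) → i Fin.≤ j → lookup p i ≤ lookup p j) ×
  (Vec.sum p ≡ n)

-- Elements of [n]: x : Fin n represents the integer toℕ x + 1.
-- A partition of [n] into labelled sets A_1..A_k is a map c : Fin n → Fin k
-- (A_i = c⁻¹(i)).
block : ∀ {n k} → (Fin n → Fin k) → Fin k → List (Fin n)
block {n} c i = filter (λ x → c x ≟ i) (allFin n)

blockSize : ∀ {n k} → (Fin n → Fin k) → Fin k → ℕ
blockSize c i = length (block c i)

blockSum : ∀ {n k} → (Fin n → Fin k) → Fin k → ℕ
blockSum c i = sum (map (λ x → suc (toℕ x)) (block c i))

Equitable : (n k : ℕ) → Vec ℕ k → Set
Equitable n k p =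
  Σ (Fin n → Fin k) λ c →
    (∀ (i : Fin k) → blockSize c i ≡ lookup p i) ×
    (∀ (i j : Fin k) → blockSum c i ≡ blockSum c j)

s : (n k : ℕ) → .{{NonZero k}} → ℚ
s n k = _/_ (+ (n * suc n)) (2 * k) {{m*n≢0 2 k}}

IsInteger : ℚ → Set
IsInteger q = ∃ λ (z : ℤ) → q ≡ z / 1

prefixSum : ∀ {k} → Vec ℕ k → ℕ → ℕ
prefixSum p j = sum (take j (toList p))

topSum : ℕ → ℕ → ℕ
topSum n m = sum (map (λ i → n ∸ i) (upTo m))

slackAt : (n k : ℕ) → .{{NonZero k}} → Vec ℕ k → ℕ → ℚ
slackAt n k p j = (+ topSum n (prefixSum p j)) / 1 ℚ.- (((+ j) / 1) ℚ.* s n k)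

SlackNonneg : (n k : ℕ) → .{{NonZero k}} → Vec ℕ k → Set
SlackNonneg n k p = ∀ (j : ℕ) → 1 ≤ j → j < k → 0ℚ ℚ.≤ slackAt n k p j

Completes : ∀ {k} → Vec ℕ k → ℕ → ℕ → Set
Completes {k} p e f =
  (e + f ≤ k) ×
  (∀ (i : Fin k) → toℕ i < e → lookup p i ≡ 2) ×
  (∀ (i : Fin k) → e ≤ toℕ i → toℕ i < e + f → lookup p i ≡ 3)

GoodCounterexample : (n k e f : ℕ) → .{{NonZero k}} → Set
GoodCounterexample n k e f =
  Σ (Vec ℕ k) λ p →
    IsAscendingPartition n k p ×
    Completes p e f ×
    IsInteger (s n k) ×
    SlackNonneg n k p ×
    (Equitable n k p → ⊥)

{-# OPTIONS --safe #-}
-- The partition is the staircase 2^e 3^f 6^r L, with r and L chosen so that it has k parts summing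
-- to n, and S = s^{n,k} is an integer.
-- Slack: with G = p₁ + ⋯ + p_j, twice slack_j is G(2n+1) − G² − 2jS, which is concave along each
-- run of equal parts; so it is nonnegative as soon as it is at the ends of the runs of 2s, 3s and 6s,
-- three explicit polynomial inequalities in t.
-- Not equitable: every block would sum to S, so both elements of a 2-block exceed A = S − n − 1, and
-- so does the largest element of a 3-block since 3A < S + 3. That needs 2e + f elements of [n]
-- above A, but there are only n − A < 2e + f of them.
module Submission where

open import Defs
open import Data.Bool using (true; false; if_then_else_)
open import Data.Fin as Fin using (Fin; toℕ)
open import Data.Fin.Properties using (_≟_; toℕ<n)
import Data.Integer as ℤ
import Data.Integer.Properties as ℤ
open import Data.List using (List; []; _∷_; [_]; _∷ʳ_; length; map; filter; applyUpTo; tabulate; allFin)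
open import Data.List.Properties using (applyUpTo-∷ʳ; map-upTo)
open import Data.List.Relation.Unary.AllPairs as AllPairs using (AllPairs)
import Data.List.Relation.Unary.AllPairs.Properties as AllPairs
import Data.List.Relation.Unary.All as All
open import Data.Nat.Base using (ℕ; zero; suc; _+_; _*_; _∸_; _/_; _≤_; _<_; z≤n; s≤s; z<s; s<s)
open import Data.Nat.Coprimality using (1-coprimeTo)
import Data.Nat.Coprimality as Coprime
open import Data.Nat.Divisibility using (_∣_; divides; ∣-refl; ∣m∣n⇒∣m+n; n∣m*n)
open import Data.Nat.DivMod using (m*n/n≡m; +-distrib-/-∣ʳ)
open import Data.Nat.ListAction using (sum)
open import Data.Nat.ListAction.Properties using (sum-++)
open import Data.Nat.Properties hiding (_≟_)
open import Data.Nat.Tactic.RingSolver using (solve; solve-∀)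
open import Data.Product using (∃-syntax; _×_; _,_; proj₁; proj₂)
open import Data.Rational as ℚ using (ℚ; mkℚ; 0ℚ)
import Data.Rational.Properties as ℚ
open import Data.Rational.Unnormalised using (mkℚᵘ; *≡*)
open import Data.Vec as Vec using (Vec; lookup)
open import Data.Vec.Properties using (lookup∘tabulate)
open import Function using (_∘_)
open import Relation.Binary using (_Preserves_⟶_)
open import Relation.Binary.PropositionalEquality
  using (_≡_; refl; sym; trans; cong; cong₂; subst; subst₂; module ≡-Reasoning)
open import Relation.Nullary using (¬_; does; yes; no; contradiction)
open import Algebra.Properties.CommutativeMonoid.Sum +-0-commutativeMonoid
  using (sum-syntax; sum-cong-≗; sum-replicate-zero; ∑-distrib-+)

m+d≡n⇒m≤n : ∀ {m n} d → m + d ≡ n → m ≤ n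
m+d≡n⇒m≤n {m} d refl = m≤m+n m d

prepend : ℕ → ℕ → (ℕ → ℕ) → ℕ → ℕ
prepend zero    v g j       = g j
prepend (suc c) v g zero    = v
prepend (suc c) v g (suc j) = prepend c v g j

prepend-< : ∀ c v g {j} → j < c → prepend c v g j ≡ v
prepend-< (suc c) v g {zero}  _         = refl
prepend-< (suc c) v g {suc j} (s≤s j<c) = prepend-< c v g j<c

prepend-+ : ∀ c v g j → prepend c v g (c + j) ≡ g j
prepend-+ zero    v g j = refl
prepend-+ (suc c) v g j = prepend-+ c v g j

AscendingFrom : ℕ → (ℕ → ℕ) → Set
AscendingFrom v g = (∀ j → v ≤ g j) × g Preserves _≤_ ⟶ _≤_

prepend-ascending : ∀ c {u v g} → u ≤ v → AscendingFrom v g → AscendingFrom u (prepend c u g)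
prepend-ascending zero    u≤v (v≤g , mono) = (λ j → ≤-trans u≤v (v≤g j)) , mono
prepend-ascending (suc c) {u} {g = g} u≤v asc = bound , mono
  where
    tail : AscendingFrom u (prepend c u g)
    tail = prepend-ascending c u≤v asc
    bound : ∀ j → u ≤ prepend (suc c) u g j
    bound zero    = ≤-refl
    bound (suc j) = proj₁ tail j
    mono : prepend (suc c) u g Preserves _≤_ ⟶ _≤_
    mono {zero}  {j}     _         = bound j
    mono {suc i} {suc j} (s≤s i≤j) = proj₂ tail i≤j

sum-prepend-≤ : ∀ c v g {i} → i ≤ c → sum (applyUpTo (prepend c v g) i) ≡ i * v
sum-prepend-≤ c       v g {zero}  _         = refl
sum-prepend-≤ (suc c) v g {suc i} (s≤s i≤c) = cong (v +_) (sum-prepend-≤ c v g i≤c)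

sum-prepend-+ : ∀ c v g i → sum (applyUpTo (prepend c v g) (c + i)) ≡ c * v + sum (applyUpTo g i)
sum-prepend-+ zero    v g i = refl
sum-prepend-+ (suc c) v g i = trans (cong (v +_) (sum-prepend-+ c v g i)) (sym (+-assoc v (c * v) _))

sum-applyUpTo-mono : ∀ g {i j} → i ≤ j → sum (applyUpTo g i) ≤ sum (applyUpTo g j)
sum-applyUpTo-mono g {zero}          _         = z≤n
sum-applyUpTo-mono g {suc i} {suc j} (s≤s i≤j) = +-monoʳ-≤ (g 0) (sum-applyUpTo-mono (g ∘ suc) i≤j)

sum-applyUpTo-suc : ∀ n → 2 * sum (applyUpTo suc n) ≡ n * suc n
sum-applyUpTo-suc zero    = refl
sum-applyUpTo-suc (suc n) = begin
  2 * sum (applyUpTo suc (suc n))              ≡⟨ cong (λ xs → 2 * sum xs) (applyUpTo-∷ʳ suc n) ⟨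
  2 * sum (applyUpTo suc n ∷ʳ suc n)           ≡⟨ cong (2 *_) (sum-++ (applyUpTo suc n) [ suc n ]) ⟩
  2 * (sum (applyUpTo suc n) + (suc n + 0))    ≡⟨ *-distribˡ-+ 2 (sum (applyUpTo suc n)) _ ⟩
  2 * sum (applyUpTo suc n) + 2 * (suc n + 0)  ≡⟨ cong (_+ 2 * (suc n + 0)) (sum-applyUpTo-suc n) ⟩
  n * suc n + 2 * (suc n + 0)                  ≡⟨ solve (n ∷ []) ⟩
  suc n * suc (suc n)                          ∎
  where open ≡-Reasoning

sum-applyUpTo-∸ : ∀ {n G} → G ≤ n → 2 * sum (applyUpTo (n ∸_) G) + G * G ≡ G * (2 * n + 1)
sum-applyUpTo-∸ {n}     {zero}  _         = refl
sum-applyUpTo-∸ {suc n} {suc G} (s≤s G≤n) = begin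
  2 * (suc n + T) + suc G * suc G        ≡⟨ regroup n G T ⟩
  (2 * T + G * G) + (2 * n + 2 * G + 3)  ≡⟨ cong (_+ (2 * n + 2 * G + 3)) (sum-applyUpTo-∸ G≤n) ⟩
  G * (2 * n + 1) + (2 * n + 2 * G + 3)  ≡⟨ regroup′ n G ⟩
  suc G * (2 * suc n + 1)                ∎
  where
    open ≡-Reasoning
    T = sum (applyUpTo (n ∸_) G)
    regroup : ∀ n G T → 2 * (suc n + T) + suc G * suc G ≡ (2 * T + G * G) + (2 * n + 2 * G + 3)
    regroup = solve-∀
    regroup′ : ∀ n G → G * (2 * n + 1) + (2 * n + 2 * G + 3) ≡ suc G * (2 * suc n + 1)
    regroup′ = solve-∀

topSum-closed : ∀ {n G} → G ≤ n → 2 * topSum n G + G * G ≡ G * (2 * n + 1)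
topSum-closed {n} {G} G≤n rewrite map-upTo (n ∸_) G = sum-applyUpTo-∸ G≤n

𝟙[_≤_] : ℕ → ℕ → ℕ
𝟙[ zero  ≤ _     ] = 1
𝟙[ suc A ≤ zero  ] = 0
𝟙[ suc A ≤ suc x ] = 𝟙[ A ≤ x ]

𝟙-≤ : ∀ {A x} → A ≤ x → 𝟙[ A ≤ x ] ≡ 1
𝟙-≤ {zero}          _         = refl
𝟙-≤ {suc A} {suc x} (s≤s A≤x) = 𝟙-≤ A≤x

count-≥ : ∀ {A n} → A ≤ n → sum (applyUpTo 𝟙[ A ≤_] n) + A ≡ n
count-≥ {zero}  {zero}  _         = refl
count-≥ {zero}  {suc n} _         = cong suc (count-≥ {zero} {n} z≤n)
count-≥ {suc A} {suc n} (s≤s A≤n) = trans (+-suc _ A) (cong suc (count-≥ A≤n))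

sum-tabulate-toℕ : ∀ k (P : ℕ → ℕ) → Vec.sum (Vec.tabulate {n = k} (P ∘ toℕ)) ≡ sum (applyUpTo P k)
sum-tabulate-toℕ zero    P = refl
sum-tabulate-toℕ (suc k) P = cong (P 0 +_) (sum-tabulate-toℕ k (P ∘ suc))

prefixSum-tabulate-toℕ : ∀ {k} (P : ℕ → ℕ) {j} → j ≤ k →
                         prefixSum (Vec.tabulate {n = k} (P ∘ toℕ)) j ≡ sum (applyUpTo P j)
prefixSum-tabulate-toℕ         P {zero}  _         = refl
prefixSum-tabulate-toℕ {suc k} P {suc j} (s≤s j≤k) = cong (P 0 +_) (prefixSum-tabulate-toℕ (P ∘ suc) j≤k)

toℚ : ℕ → ℚ
toℚ a = ℤ.+ a ℚ./ 1

toℚ≡mkℚ : ∀ a → toℚ a ≡ mkℚ (ℤ.+ a) 0 (Coprime.sym (1-coprimeTo a))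
toℚ≡mkℚ a = ℚ.normalize-coprime (Coprime.sym (1-coprimeTo a))

toℚ-mono-≤ : ∀ {a b} → a ≤ b → toℚ a ℚ.≤ toℚ b
toℚ-mono-≤ {a} {b} a≤b rewrite toℚ≡mkℚ a | toℚ≡mkℚ b =
  ℚ.*≤* (subst₂ ℤ._≤_ (sym (ℤ.*-identityʳ (ℤ.+ a))) (sym (ℤ.*-identityʳ (ℤ.+ b))) (ℤ.+≤+ a≤b))

toℚ-* : ∀ a b → toℚ a ℚ.* toℚ b ≡ toℚ (a * b)
toℚ-* a b rewrite toℚ≡mkℚ a | toℚ≡mkℚ b = ℚ./-cong (sym (ℤ.pos-* a b)) refl

toℚ-≤⇒0≤- : ∀ {a b} → b ≤ a → 0ℚ ℚ.≤ toℚ a ℚ.- toℚ b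
toℚ-≤⇒0≤- {a} {b} b≤a =
  subst (ℚ._≤ toℚ a ℚ.- toℚ b) (ℚ.+-inverseʳ (toℚ b)) (ℚ.+-monoˡ-≤ (ℚ.- toℚ b) (toℚ-mono-≤ b≤a))

s≡toℚ : ∀ {n K S} → n * suc n ≡ S * (2 * suc K) → s n (suc K) ≡ toℚ S
s≡toℚ {n} {K} {S} eq = ℚ.fromℚᵘ-cong {mkℚᵘ (ℤ.+ (n * suc n)) (K + (suc K + 0))} {mkℚᵘ (ℤ.+ S) 0}
  (*≡* (trans (ℤ.*-identityʳ (ℤ.+ (n * suc n))) (trans (cong ℤ.+_ eq) (ℤ.pos-* S (2 * suc K)))))

-- slack_j ≥ 0 for G = p₁ + ⋯ + p_j and S = s^{n,k}, doubled and with the subtraction moved across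
-- (see topSum-closed).
record Slack≥0 (n S j G : ℕ) : Set where
  constructor slack≥0
  field
    fits : 2 * j * S + G * G ≤ G * (2 * n + 1)

Slack≥0⇒≤topSum : ∀ {n S j G} → G ≤ n → Slack≥0 n S j G → j * S ≤ topSum n G
Slack≥0⇒≤topSum {n} {S} {j} {G} G≤n (slack≥0 fits) = *-cancelˡ-≤ 2 (+-cancelʳ-≤ (G * G) _ _ doubled)
  where
    doubled : 2 * (j * S) + G * G ≤ 2 * topSum n G + G * G
    doubled = subst₂ _≤_ (cong (_+ G * G) (*-assoc 2 j S)) (sym (topSum-closed G≤n)) fits

slackAt-nonneg : ∀ {n K S j} (p : Vec ℕ (suc K)) → n * suc n ≡ S * (2 * suc K) →
                 prefixSum p j ≤ n → Slack≥0 n S j (prefixSum p j) → 0ℚ ℚ.≤ slackAt n (suc K) p j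
slackAt-nonneg {n} {K} {S} {j} p integral G≤n fits =
  subst (λ q → 0ℚ ℚ.≤ toℚ (topSum n (prefixSum p j)) ℚ.- q)
        (sym (trans (cong (toℚ j ℚ.*_) (s≡toℚ {n} {K} {S} integral)) (toℚ-* j S)))
        (toℚ-≤⇒0≤- (Slack≥0⇒≤topSum G≤n fits))

-- With r = i + d, r times the slack after i blocks of size c is d times the slack before the run
-- plus i times the slack after it plus c²·r·i·d: the slack is concave along a run of equal blocks.
run-interpolation : ∀ n S j G c i d →
  (i + d) * (2 * (j + i) * S + (G + i * c) * (G + i * c)) + c * c * ((i + d) * i * d)
    + (d * (G * (2 * n + 1)) + i * ((G + (i + d) * c) * (2 * n + 1)))
  ≡ (i + d) * ((G + i * c) * (2 * n + 1))
    + (d * (2 * j * S + G * G) + i * (2 * (j + (i + d)) * S + (G + (i + d) * c) * (G + (i + d) * c)))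
run-interpolation = solve-∀

Slack≥0-concave : ∀ {n S j G} c {i r} → i ≤ r → Slack≥0 n S j G → Slack≥0 n S (j + r) (G + r * c) →
                  Slack≥0 n S (j + i) (G + i * c)
Slack≥0-concave {n} {S} {j} {G} c {zero} _ slack₀ _ =
  subst₂ (Slack≥0 n S) (sym (+-identityʳ j)) (sym (+-identityʳ G)) slack₀
Slack≥0-concave {n} {S} {j} {G} c {i@(suc _)} i≤r (slack≥0 slack₀) (slack≥0 slackᵣ)
  with m≤n⇒∃[o]m+o≡n i≤r
... | d , refl = slack≥0 (*-cancelˡ-≤ (i + d) (≤-trans (m≤m+n _ _) (+-cancelʳ-≤ _ _ _ interpolated)))
  where
    lhs : ℕ → ℕ → ℕ
    lhs j G = 2 * j * S + G * G
    rhs : ℕ → ℕ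
    rhs G = G * (2 * n + 1)
    ends : ℕ
    ends = d * rhs G + i * rhs (G + (i + d) * c)
    interpolated : (i + d) * lhs (j + i) (G + i * c) + c * c * ((i + d) * i * d) + ends
                   ≤ (i + d) * rhs (G + i * c) + ends
    interpolated = begin
      (i + d) * lhs (j + i) (G + i * c) + c * c * ((i + d) * i * d) + ends
        ≡⟨ run-interpolation n S j G c i d ⟩
      (i + d) * rhs (G + i * c) + (d * lhs j G + i * lhs (j + (i + d)) (G + (i + d) * c))
        ≤⟨ +-monoʳ-≤ ((i + d) * rhs (G + i * c)) (+-mono-≤ (*-monoʳ-≤ d slack₀) (*-monoʳ-≤ i slackᵣ)) ⟩
      (i + d) * rhs (G + i * c) + ends
        ∎
      where open ≤-Reasoning

Slack≥0-run : ∀ {n S j G} c v g → Slack≥0 n S j G → Slack≥0 n S (j + c) (G + c * v) →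
              ∀ i → i ≤ c → Slack≥0 n S (j + i) (G + sum (applyUpTo (prepend c v g) i))
Slack≥0-run {n} {S} {j} {G} c v g slack₀ slackᵣ i i≤c =
  subst (λ X → Slack≥0 n S (j + i) (G + X)) (sym (sum-prepend-≤ c v g i≤c))
        (Slack≥0-concave v i≤c slack₀ slackᵣ)

Slack≥0-prepend : ∀ {n S j G} c v g m → Slack≥0 n S j G → Slack≥0 n S (j + c) (G + c * v) →
                  (∀ i → i ≤ m → Slack≥0 n S (j + c + i) (G + c * v + sum (applyUpTo g i))) →
                  ∀ i → i ≤ c + m → Slack≥0 n S (j + i) (G + sum (applyUpTo (prepend c v g) i))
Slack≥0-prepend {n} {S} {j} {G} c v g m slack₀ slackᵣ rest i i≤c+m with i ≤? c
... | yes i≤c = Slack≥0-run c v g slack₀ slackᵣ i i≤c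
... | no  i≰c with m≤n⇒∃[o]m+o≡n (≰⇒≥ i≰c)
...   | i′ , refl =
  subst₂ (Slack≥0 n S) (+-assoc j c i′)
         (trans (+-assoc G (c * v) _) (cong (G +_) (sym (sum-prepend-+ c v g i′))))
         (rest i′ (+-cancelˡ-≤ c i′ m i≤c+m))

staircase : (e f r L : ℕ) → ℕ → ℕ
staircase e f r L = prepend e 2 (prepend f 3 (prepend r 6 (λ _ → L)))

staircase-2s : ∀ e f r L {j} → j < e → staircase e f r L j ≡ 2
staircase-2s e f r L = prepend-< e 2 _

staircase-3s : ∀ e f r L {j} → e ≤ j → j < e + f → staircase e f r L j ≡ 3
staircase-3s e f r L e≤j j<e+f with m≤n⇒∃[o]m+o≡n e≤j
... | d , refl = trans (prepend-+ e 2 _ d) (prepend-< f 3 _ (+-cancelˡ-< e d f j<e+f))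

staircase-ascending : ∀ e f r {L} → 6 ≤ L → AscendingFrom 2 (staircase e f r L)
staircase-ascending e f r 6≤L =
  prepend-ascending e (n≤1+n 2)
    (prepend-ascending f (m≤m+n 3 3)
      (prepend-ascending r 6≤L ((λ _ → ≤-refl) , λ _ → ≤-refl)))

sum-staircase : ∀ e f r L →
                sum (applyUpTo (staircase e f r L) (e + (f + (r + 1)))) ≡ e * 2 + (f * 3 + (r * 6 + L))
sum-staircase e f r L = begin
  sum (applyUpTo (staircase e f r L) (e + (f + (r + 1))))  ≡⟨ sum-prepend-+ e 2 _ _ ⟩
  e * 2 + sum (applyUpTo (prepend f 3 _) (f + (r + 1)))    ≡⟨ cong (e * 2 +_) (sum-prepend-+ f 3 _ _) ⟩
  e * 2 + (f * 3 + sum (applyUpTo (prepend r 6 _) (r + 1)))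
    ≡⟨ cong (λ X → e * 2 + (f * 3 + X)) (sum-prepend-+ r 6 _ 1) ⟩
  e * 2 + (f * 3 + (r * 6 + (L + 0)))
    ≡⟨ cong (λ X → e * 2 + (f * 3 + (r * 6 + X))) (+-identityʳ L) ⟩
  e * 2 + (f * 3 + (r * 6 + L))                            ∎
  where open ≡-Reasoning

staircase-slack : ∀ {n S} e f r L → Slack≥0 n S e (e * 2) → Slack≥0 n S (e + f) (e * 2 + f * 3) →
                  Slack≥0 n S (e + f + r) (e * 2 + f * 3 + r * 6) →
                  ∀ j → j ≤ e + (f + r) → Slack≥0 n S j (sum (applyUpTo (staircase e f r L) j))
staircase-slack e f r L slack₂ slack₃ slack₆ =
  Slack≥0-prepend e 2 _ (f + r) (slack≥0 z≤n) slack₂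
    (Slack≥0-prepend f 3 _ r slack₂ slack₃
      (Slack≥0-run r 6 _ slack₃ slack₆))

∑-const : ∀ k c → ∑[ i < k ] c ≡ k * c
∑-const zero    c = refl
∑-const (suc k) c = cong (c +_) (∑-const k c)

∑-toℕ : ∀ k (g : ℕ → ℕ) → ∑[ i < k ] g (toℕ i) ≡ sum (applyUpTo g k)
∑-toℕ zero    g = refl
∑-toℕ (suc k) g = cong (g 0 +_) (∑-toℕ k (g ∘ suc))

∑-indicator : ∀ {k} (j : Fin k) a → ∑[ i < k ] (if does (j ≟ i) then a else 0) ≡ a
∑-indicator {suc k} Fin.zero    a = trans (cong (a +_) (sum-replicate-zero k)) (+-identityʳ a)
∑-indicator {suc k} (Fin.suc j) a = ∑-indicator j a

sum-map-tabulate : ∀ {A : Set} {n} (w : A → ℕ) (f : Fin n → A) →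
                   sum (map w (tabulate f)) ≡ ∑[ i < n ] w (f i)
sum-map-tabulate {n = zero}  w f = refl
sum-map-tabulate {n = suc n} w f = cong (w (f Fin.zero) +_) (sum-map-tabulate w (f ∘ Fin.suc))

sum-map-allFin : ∀ n (g : ℕ → ℕ) → sum (map (g ∘ toℕ) (allFin n)) ≡ sum (applyUpTo g n)
sum-map-allFin n g = trans (sum-map-tabulate {n = n} (g ∘ toℕ) (λ x → x)) (∑-toℕ n g)

sum-blocks : ∀ {n k} (c : Fin n → Fin k) (w : Fin n → ℕ) xs →
             ∑[ i < k ] sum (map w (filter (λ x → c x ≟ i) xs)) ≡ sum (map w xs)
sum-blocks {k = k} c w []       = sum-replicate-zero k
sum-blocks {k = k} c w (x ∷ xs) = begin
  ∑[ i < k ] sum (map w (filter (λ y → c y ≟ i) (x ∷ xs)))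
    ≡⟨ sum-cong-≗ split ⟩
  ∑[ i < k ] ((if does (c x ≟ i) then w x else 0) + sum (map w (filter (λ y → c y ≟ i) xs)))
    ≡⟨ ∑-distrib-+ (λ i → if does (c x ≟ i) then w x else 0) _ ⟩
  ∑[ i < k ] (if does (c x ≟ i) then w x else 0) + ∑[ i < k ] sum (map w (filter (λ y → c y ≟ i) xs))
    ≡⟨ cong₂ _+_ (∑-indicator (c x) (w x)) (sum-blocks c w xs) ⟩
  w x + sum (map w xs) ∎
  where
    open ≡-Reasoning
    split : ∀ i → sum (map w (filter (λ y → c y ≟ i) (x ∷ xs)))
                  ≡ (if does (c x ≟ i) then w x else 0) + sum (map w (filter (λ y → c y ≟ i) xs))
    split i with does (c x ≟ i)
    ... | true  = refl
    ... | false = refl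

blockSum≡ : ∀ {n K S} (c : Fin n → Fin (suc K)) → n * suc n ≡ S * (2 * suc K) →
            (∀ i j → blockSum c i ≡ blockSum c j) → ∀ i → blockSum c i ≡ S
blockSum≡ {n} {K} {S} c integral equal i = *-cancelˡ-≡ (blockSum c i) S (2 * suc K) (begin
  2 * suc K * blockSum c i                           ≡⟨ *-assoc 2 (suc K) _ ⟩
  2 * (suc K * blockSum c i)                         ≡⟨ cong (2 *_) (∑-const (suc K) (blockSum c i)) ⟨
  2 * ∑[ j < suc K ] blockSum c i                    ≡⟨ cong (2 *_) (sum-cong-≗ (λ j → equal j i)) ⟨
  2 * ∑[ j < suc K ] blockSum c j                    ≡⟨ cong (2 *_) (sum-blocks c (λ x → suc (toℕ x)) (allFin n)) ⟩
  2 * sum (map (λ x → suc (toℕ x)) (allFin n))       ≡⟨ cong (2 *_) (sum-map-allFin n suc) ⟩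
  2 * sum (applyUpTo suc n)                          ≡⟨ sum-applyUpTo-suc n ⟩
  n * suc n                                          ≡⟨ integral ⟩
  S * (2 * suc K)                                    ≡⟨ *-comm S (2 * suc K) ⟩
  2 * suc K * S                                      ∎)
  where open ≡-Reasoning

block-sorted : ∀ {n k} (c : Fin n → Fin k) i → AllPairs (λ x y → toℕ x < toℕ y) (block c i)
block-sorted {n} c i = AllPairs.filter⁺ (λ x → c x ≟ i) (AllPairs.tabulate⁺-< (λ x<y → x<y))

partner-≥ : ∀ {n A a} (y : Fin n) → suc a + suc (toℕ y) ≡ suc A + n → A ≤ a
partner-≥ {n} {A} {a} y eq =
  ≤-pred (+-cancelʳ-≤ n (suc A) (suc a) (subst (_≤ suc a + n) eq (+-monoʳ-≤ (suc a) (toℕ<n y))))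

pair-big : ∀ {n A} (xs : List (Fin n)) → length xs ≡ 2 → sum (map (λ x → suc (toℕ x)) xs) ≡ suc A + n →
           2 ≤ sum (map (𝟙[ A ≤_] ∘ toℕ) xs)
pair-big {n} {A} (x ∷ y ∷ []) _ eq =
  ≤-reflexive (sym (cong₂ (λ a b → a + (b + 0)) (𝟙-≤ (partner-≥ y x+y)) (𝟙-≤ (partner-≥ x y+x))))
  where
    x+y : suc (toℕ x) + suc (toℕ y) ≡ suc A + n
    x+y = trans (cong (suc (toℕ x) +_) (sym (+-identityʳ _))) eq
    y+x : suc (toℕ y) + suc (toℕ x) ≡ suc A + n
    y+x = trans (+-comm (suc (toℕ y)) (suc (toℕ x))) x+y

triple-big : ∀ {n A S} (xs : List (Fin n)) → AllPairs (λ x y → toℕ x < toℕ y) xs → length xs ≡ 3 →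
             sum (map (λ x → suc (toℕ x)) xs) ≡ S → 3 * A < S + 3 → 1 ≤ sum (map (𝟙[ A ≤_] ∘ toℕ) xs)
triple-big {A = A} {S} (x ∷ y ∷ z ∷ []) ((x<y All.∷ _) AllPairs.∷ (y<z All.∷ _) AllPairs.∷ _) _ eq 3A<S+3
  with A ≤? toℕ z
... | yes A≤z rewrite 𝟙-≤ A≤z =
  ≤-trans (m≤n+m 1 𝟙[ A ≤ toℕ y ]) (m≤n+m (𝟙[ A ≤ toℕ y ] + 1) 𝟙[ A ≤ toℕ x ])
... | no  A≰z = contradiction 3A<S+3 (≤⇒≯ S+3≤3A)
  where
    z<A : toℕ z < A
    z<A = ≰⇒> A≰z
    S+3≤3A : S + 3 ≤ 3 * A
    S+3≤3A = subst₂ _≤_ (trans (regroup (toℕ x) (toℕ y) (toℕ z)) (cong (_+ 3) eq)) (thrice A)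
      (+-mono-≤ (+-mono-≤ (≤-trans (s≤s (s≤s x<y)) (≤-trans (s≤s y<z) z<A)) (≤-trans (s≤s y<z) z<A)) z<A)
      where
        regroup : ∀ x y z → 3 + x + (2 + y) + (1 + z) ≡ suc x + (suc y + (suc z + 0)) + 3
        regroup = solve-∀
        thrice : ∀ A → A + A + A ≡ 3 * A
        thrice = solve-∀

e*2+f≤∑ : ∀ {k} e f (F : Fin k → ℕ) → e + f ≤ k →
          (∀ i → toℕ i < e → 2 ≤ F i) → (∀ i → e ≤ toℕ i → toℕ i < e + f → 1 ≤ F i) →
          e * 2 + f ≤ ∑[ i < k ] F i
e*2+f≤∑ {zero}  zero    zero    F _           _   _   = z≤n
e*2+f≤∑ {suc k} zero    zero    F _           _   _   = z≤n
e*2+f≤∑ {suc k} (suc e) f       F (s≤s e+f≤k) two one =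
  +-mono-≤ (two Fin.zero z<s)
    (e*2+f≤∑ e f (F ∘ Fin.suc) e+f≤k (λ i i<e → two (Fin.suc i) (s<s i<e))
      (λ i e≤i i<e+f → one (Fin.suc i) (s≤s e≤i) (s<s i<e+f)))
e*2+f≤∑ {suc k} zero    (suc f) F (s≤s f≤k)   _   one =
  +-mono-≤ (one Fin.zero z≤n z<s)
    (e*2+f≤∑ zero f (F ∘ Fin.suc) f≤k (λ _ ()) (λ i _ i<f → one (Fin.suc i) z≤n (s<s i<f)))

¬equitable : ∀ {n K e f S A} (p : Vec ℕ (suc K)) → Completes p e f → n * suc n ≡ S * (2 * suc K) →
             S ≡ suc A + n → A ≤ n → n < A + (e * 2 + f) → 3 * A < S + 3 → ¬ Equitable n (suc K) p
¬equitable {n} {K} {e} {f} {S} {A} p (e+f≤k , twos , threes) integral S≡ A≤n few-big triple (c , size , equal) =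
  <⇒≱ few-big (begin
    A + (e * 2 + f)                    ≤⟨ +-monoʳ-≤ A (e*2+f≤∑ e f big e+f≤k in-pair in-triple) ⟩
    A + ∑[ i < suc K ] big i           ≡⟨ cong (A +_) (sum-blocks c (𝟙[ A ≤_] ∘ toℕ) (allFin n)) ⟩
    A + sum (map (𝟙[ A ≤_] ∘ toℕ) (allFin n)) ≡⟨ cong (A +_) (sum-map-allFin n 𝟙[ A ≤_]) ⟩
    A + sum (applyUpTo 𝟙[ A ≤_] n)     ≡⟨ +-comm A _ ⟩
    sum (applyUpTo 𝟙[ A ≤_] n) + A     ≡⟨ count-≥ A≤n ⟩
    n                                  ∎)
  where
    open ≤-Reasoning
    big : Fin (suc K) → ℕ
    big i = sum (map (𝟙[ A ≤_] ∘ toℕ) (block c i))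
    blockSum≡S : ∀ i → blockSum c i ≡ S
    blockSum≡S = blockSum≡ c integral equal
    in-pair : ∀ i → toℕ i < e → 2 ≤ big i
    in-pair i i<e = pair-big (block c i) (trans (size i) (twos i i<e)) (trans (blockSum≡S i) S≡)
    in-triple : ∀ i → e ≤ toℕ i → toℕ i < e + f → 1 ≤ big i
    in-triple i e≤i i<e+f =
      triple-big {A = A} (block c i) (block-sorted c i) (trans (size i) (threes i e≤i i<e+f)) (blockSum≡S i) triple

record Staircase (n K e f : ℕ) : Set where
  field
    r L S A  : ℕ
    size     : K ≡ e + (f + r)
    total    : n ≡ e * 2 + (f * 3 + (r * 6 + L))
    6≤L      : 6 ≤ L
    integral : n * suc n ≡ S * (2 * suc K)
    slack₂   : Slack≥0 n S e (e * 2)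
    slack₃   : Slack≥0 n S (e + f) (e * 2 + f * 3)
    slack₆   : Slack≥0 n S (e + f + r) (e * 2 + f * 3 + r * 6)
    S≡       : S ≡ suc A + n
    A≤n      : A ≤ n
    few-big  : n < A + (e * 2 + f)
    triple   : 3 * A < S + 3

  P : ℕ → ℕ
  P = staircase e f r L

  partition : Vec ℕ (suc K)
  partition = Vec.tabulate (P ∘ toℕ)

  lookup-partition : ∀ i → lookup partition i ≡ P (toℕ i)
  lookup-partition = lookup∘tabulate (P ∘ toℕ)

  sum-P : sum (applyUpTo P (suc K)) ≡ n
  sum-P = begin
    sum (applyUpTo P (suc K))               ≡⟨ cong (sum ∘ applyUpTo P) (trans (cong suc size) (regroup e f r)) ⟩
    sum (applyUpTo P (e + (f + (r + 1))))   ≡⟨ sum-staircase e f r L ⟩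
    e * 2 + (f * 3 + (r * 6 + L))           ≡⟨ total ⟨
    n                                       ∎
    where
      open ≡-Reasoning
      regroup : ∀ e f r → suc (e + (f + r)) ≡ e + (f + (r + 1))
      regroup = solve-∀

  ascending-partition : IsAscendingPartition n (suc K) partition
  ascending-partition =
    (λ i → subst (1 ≤_) (sym (lookup-partition i)) (≤-trans (s≤s z≤n) (proj₁ ascending-P (toℕ i)))) ,
    (λ i j i≤j → subst₂ _≤_ (sym (lookup-partition i)) (sym (lookup-partition j)) (proj₂ ascending-P i≤j)) ,
    trans (sum-tabulate-toℕ (suc K) P) sum-P
    where
      ascending-P : AscendingFrom 2 P
      ascending-P = staircase-ascending e f r 6≤L

  completes : Completes partition e f
  completes =
    ≤-trans (+-monoʳ-≤ e (m≤m+n f r)) (≤-trans (≤-reflexive (sym size)) (n≤1+n K)) ,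
    (λ i i<e → trans (lookup-partition i) (staircase-2s e f r L i<e)) ,
    (λ i e≤i i<e+f → trans (lookup-partition i) (staircase-3s e f r L e≤i i<e+f))

  slack-nonneg : SlackNonneg n (suc K) partition
  slack-nonneg j _ j<k = slackAt-nonneg partition integral G≤n (subst (Slack≥0 n S j) (sym G≡) fits)
    where
      j≤k = <⇒≤ j<k
      G≡ : prefixSum partition j ≡ sum (applyUpTo P j)
      G≡ = prefixSum-tabulate-toℕ P j≤k
      G≤n : prefixSum partition j ≤ n
      G≤n = subst₂ _≤_ (sym G≡) sum-P (sum-applyUpTo-mono P j≤k)
      fits : Slack≥0 n S j (sum (applyUpTo P j))
      fits = staircase-slack e f r L slack₂ slack₃ slack₆ j (subst (j ≤_) size (≤-pred j<k))

  counterexample : GoodCounterexample n (suc K) e f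
  counterexample =
    partition , ascending-partition , completes , (ℤ.+ S , s≡toℚ {n} {K} {S} integral) , slack-nonneg ,
    ¬equitable partition completes integral S≡ A≤n few-big triple

open Staircase using (counterexample)

even-≥ : ∀ {P : ℕ → Set} c → (∀ x → P (2 * (c + x))) → ∀ t → 2 ∣ t → 2 * c ≤ t → P t
even-≥ {P} c P-even t (divides q refl) 2c≤t
  with m≤n⇒∃[o]m+o≡n (*-cancelʳ-≤ c q 2 (subst (_≤ q * 2) (*-comm 2 c) 2c≤t))
... | x , refl = subst P (*-comm 2 (c + x)) (P-even x)

odd⇒suc-even : ∀ t → ¬ 2 ∣ t → ∃[ q ] t ≡ suc (q * 2)
odd⇒suc-even zero          ¬2∣t = contradiction (divides 0 refl) ¬2∣t
odd⇒suc-even (suc zero)    _    = 0 , refl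
odd⇒suc-even (suc (suc t)) ¬2∣t =
  let q , t≡ = odd⇒suc-even t (¬2∣t ∘ ∣m∣n⇒∣m+n ∣-refl) in suc q , cong (suc ∘ suc) t≡

odd-≥ : ∀ {P : ℕ → Set} c → (∀ x → P (suc (2 * (c + x)))) → ∀ t → ¬ 2 ∣ t → suc (2 * c) ≤ t → P t
odd-≥ {P} c P-odd t ¬2∣t 2c<t with odd⇒suc-even t ¬2∣t
... | q , refl with m≤n⇒∃[o]m+o≡n (*-cancelʳ-≤ c q 2 (subst (_≤ q * 2) (*-comm 2 c) (≤-pred 2c<t)))
...   | x , refl = subst P (cong suc (*-comm 2 (c + x))) (P-odd x)

3*[2m]/2≡3m : ∀ m → 3 * (2 * m) / 2 ≡ 3 * m
3*[2m]/2≡3m m = trans (cong (_/ 2) (regroup m)) (m*n/n≡m (3 * m) 2)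
  where
    regroup : ∀ m → 3 * (2 * m) ≡ 3 * m * 2
    regroup = solve-∀

3*[1+2m]/2≡3m+1 : ∀ m → 3 * suc (2 * m) / 2 ≡ 3 * m + 1
3*[1+2m]/2≡3m+1 m = begin
  3 * suc (2 * m) / 2        ≡⟨ cong (_/ 2) (regroup m) ⟩
  (1 + (3 * m + 1) * 2) / 2  ≡⟨ +-distrib-/-∣ʳ 1 {d = 2} (n∣m*n (3 * m + 1)) ⟩
  (3 * m + 1) * 2 / 2        ≡⟨ m*n/n≡m (3 * m + 1) 2 ⟩
  3 * m + 1                  ∎
  where
    open ≡-Reasoning
    regroup : ∀ m → 3 * suc (2 * m) ≡ 1 + (3 * m + 1) * 2
    regroup = solve-∀

[3*[1+2m]+1]/2≡3m+2 : ∀ m → (3 * suc (2 * m) + 1) / 2 ≡ 3 * m + 2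
[3*[1+2m]+1]/2≡3m+2 m = trans (cong (_/ 2) (regroup m)) (m*n/n≡m (3 * m + 2) 2)
  where
    regroup : ∀ m → 3 * suc (2 * m) + 1 ≡ (3 * m + 2) * 2
    regroup = solve-∀

-- With t = 2m or 2m + 1 and m = m₀ + x, the margin in slack₃ is what forces m ≥ m₀.
staircase-a : ∀ x → let t = 2 * (3 + x) in Staircase (6 * t + 3) (2 * t) (3 * (3 + x)) 2
staircase-a x = record
  { r = 1 + x ; L = 9 ; S = 9 * (2 * (3 + x)) + 6 ; A = 3 * (2 * (3 + x)) + 2
  ; size     = solve (x ∷ [])
  ; total    = solve (x ∷ [])
  ; 6≤L      = m≤m+n 6 3
  ; integral = solve (x ∷ [])
  ; slack₂   = slack≥0 (m+d≡n⇒m≤n (18 + 6 * x) (solve (x ∷ [])))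
  ; slack₃   = slack≥0 (m+d≡n⇒m≤n (6 * x) (solve (x ∷ [])))
  ; slack₆   = slack≥0 (m+d≡n⇒m≤n (30 + 36 * x) (solve (x ∷ [])))
  ; S≡       = solve (x ∷ [])
  ; A≤n      = m+d≡n⇒m≤n (3 * (2 * (3 + x)) + 1) (solve (x ∷ []))
  ; few-big  = ≤-reflexive (solve (x ∷ []))
  ; triple   = m+d≡n⇒m≤n 2 (solve (x ∷ []))
  }

staircase-b : ∀ x → let t = suc (2 * (3 + x)) in Staircase (6 * t + 3) (2 * t) (3 * (3 + x) + 1) 3
staircase-b x = record
  { r = 1 + x ; L = 10 ; S = 9 * suc (2 * (3 + x)) + 6 ; A = 3 * suc (2 * (3 + x)) + 2
  ; size     = solve (x ∷ [])
  ; total    = solve (x ∷ [])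
  ; 6≤L      = m≤m+n 6 4
  ; integral = solve (x ∷ [])
  ; slack₂   = slack≥0 (m+d≡n⇒m≤n (40 + 12 * x) (solve (x ∷ [])))
  ; slack₃   = slack≥0 (m+d≡n⇒m≤n (4 + 12 * x) (solve (x ∷ [])))
  ; slack₆   = slack≥0 (m+d≡n⇒m≤n (28 + 36 * x) (solve (x ∷ [])))
  ; S≡       = solve (x ∷ [])
  ; A≤n      = m+d≡n⇒m≤n (3 * suc (2 * (3 + x)) + 1) (solve (x ∷ []))
  ; few-big  = ≤-reflexive (solve (x ∷ []))
  ; triple   = m+d≡n⇒m≤n 2 (solve (x ∷ []))
  }

staircase-c : ∀ x → let t = 2 * (5 + x) in Staircase (6 * t + 2) (2 * t) (3 * (5 + x)) 3
staircase-c x = record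
  { r = 2 + x ; L = 11 ; S = 9 * (2 * (5 + x)) + 3 ; A = 3 * (2 * (5 + x))
  ; size     = solve (x ∷ [])
  ; total    = solve (x ∷ [])
  ; 6≤L      = m≤m+n 6 5
  ; integral = solve (x ∷ [])
  ; slack₂   = slack≥0 (m+d≡n⇒m≤n (60 + 12 * x) (solve (x ∷ [])))
  ; slack₃   = slack≥0 (m+d≡n⇒m≤n (6 + 12 * x) (solve (x ∷ [])))
  ; slack₆   = slack≥0 (m+d≡n⇒m≤n (54 + 36 * x) (solve (x ∷ [])))
  ; S≡       = solve (x ∷ [])
  ; A≤n      = m+d≡n⇒m≤n (3 * (2 * (5 + x)) + 2) (solve (x ∷ []))
  ; few-big  = ≤-reflexive (solve (x ∷ []))
  ; triple   = m+d≡n⇒m≤n 5 (solve (x ∷ []))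
  }

staircase-d : ∀ x → let t = suc (2 * (5 + x)) in Staircase (6 * t + 2) (2 * t) (3 * (5 + x) + 2) 2
staircase-d x = record
  { r = 3 + x ; L = 10 ; S = 9 * suc (2 * (5 + x)) + 3 ; A = 3 * suc (2 * (5 + x))
  ; size     = solve (x ∷ [])
  ; total    = solve (x ∷ [])
  ; 6≤L      = m≤m+n 6 4
  ; integral = solve (x ∷ [])
  ; slack₂   = slack≥0 (m+d≡n⇒m≤n (34 + 6 * x) (solve (x ∷ [])))
  ; slack₃   = slack≥0 (m+d≡n⇒m≤n (4 + 6 * x) (solve (x ∷ [])))
  ; slack₆   = slack≥0 (m+d≡n⇒m≤n (94 + 36 * x) (solve (x ∷ [])))
  ; S≡       = solve (x ∷ [])
  ; A≤n      = m+d≡n⇒m≤n (3 * suc (2 * (5 + x)) + 2) (solve (x ∷ []))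
  ; few-big  = ≤-reflexive (solve (x ∷ []))
  ; triple   = m+d≡n⇒m≤n 5 (solve (x ∷ []))
  }

family-a : ∀ t → 2 ∣ t → 6 ≤ t → GoodCounterexample (6 * t + 3) (suc (2 * t)) ((3 * t) / 2) 2
family-a = even-≥ 3 λ x → let t = 2 * (3 + x) in
  subst (λ e → GoodCounterexample (6 * t + 3) (suc (2 * t)) e 2)
        (sym (3*[2m]/2≡3m (3 + x))) (counterexample (staircase-a x))

family-b : ∀ t → ¬ 2 ∣ t → 7 ≤ t → GoodCounterexample (6 * t + 3) (suc (2 * t)) ((3 * t) / 2) 3
family-b = odd-≥ 3 λ x → let t = suc (2 * (3 + x)) in
  subst (λ e → GoodCounterexample (6 * t + 3) (suc (2 * t)) e 3)
        (sym (3*[1+2m]/2≡3m+1 (3 + x))) (counterexample (staircase-b x))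

family-c : ∀ t → 2 ∣ t → 10 ≤ t → GoodCounterexample (6 * t + 2) (suc (2 * t)) ((3 * t) / 2) 3
family-c = even-≥ 5 λ x → let t = 2 * (5 + x) in
  subst (λ e → GoodCounterexample (6 * t + 2) (suc (2 * t)) e 3)
        (sym (3*[2m]/2≡3m (5 + x))) (counterexample (staircase-c x))

family-d : ∀ t → ¬ 2 ∣ t → 11 ≤ t → GoodCounterexample (6 * t + 2) (suc (2 * t)) ((3 * t + 1) / 2) 2
family-d = odd-≥ 5 λ x → let t = suc (2 * (5 + x)) in
  subst (λ e → GoodCounterexample (6 * t + 2) (suc (2 * t)) e 2)
        (sym ([3*[1+2m]+1]/2≡3m+2 (5 + x))) (counterexample (staircase-d x))

theorem6p1 :
    (∀ (t : ℕ) → 2 ∣ t → 6 ≤ t →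
        GoodCounterexample (6 * t + 3) (suc (2 * t)) ((3 * t) / 2) 2) ×
    (∀ (t : ℕ) → ¬ (2 ∣ t) → 7 ≤ t →
        GoodCounterexample (6 * t + 3) (suc (2 * t)) ((3 * t) / 2) 3) ×
    (∀ (t : ℕ) → 2 ∣ t → 10 ≤ t →
        GoodCounterexample (6 * t + 2) (suc (2 * t)) ((3 * t) / 2) 3) ×
    (∀ (t : ℕ) → ¬ (2 ∣ t) → 11 ≤ t →
        GoodCounterexample (6 * t + 2) (suc (2 * t)) ((3 * t + 1) / 2) 2)
theorem6p1 = family-a , family-b , family-c , family-d
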